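{- Let $T_{g_1}$, $T_{g_2}$, $T_{g_3}$ be parse trees of labeled graphs $G_1$, $G_2$, $G_3$ respectively. If $T_{g_1}$ and $T_{g_2}$ are structurally isomorphic via the label map $\pi_1$ and $T_{g_2}$ and $T_{g_3}$ are structurally isomorphic via the label map $\pi_2$, then $T_{g_1}$ and $T_{g_3}$ are structurally isomorphic via the label map $\pi_2\circ\pi_1$.
   Context: Labeled graphs are built by the clique-width operations: $v(i)$ (new vertex $v$ with label $i$), $\oplus$ (disjoint union of any number of labeled graphs), $\eta_{i,j}$ (add all edges between label $i$ and label $j$ vertices, $i\neq j$), $\rho_{i\rightarrow j}$ (relabel $i$ to $j$). A parse tree of a labeled graph is the rooted tree of such an expression: leaves are the vertices with their initial labels, internal nodes are $\eta$, $\rho$ and $\oplus$ operations; the subtree $T_x$ rooted at a node $x$ generates a labeled graph $G_x$, and $lab(G_x)$ is its set of labels. For a $\oplus$ node $g$, a descendant $g_1$ of $g$ that is not an $\eta$ or $\rho$ node (so a $\oplus$ node or a leaf) is an immediate significant descendant of $g$ if no other $\oplus$ node lies on the path from $g$ to $g_1$. The colored quotient graph $Q_{g_1}$ is defined as follows: its vertex set is $lab(G_{g_1})$; start with each vertex $a$ colored $a$ and no edges; then process the operations on the path from $g_1$ up to $g$ in order: for $\eta_{a,b}$ add all edges between vertices of color $a$ and vertices of color $b$; for $\rho_{a\rightarrow b}$ recolor all vertices of color $a$ with color $b$. A bijection $\sigma:V(Q)\to V(Q')$ between colored graphs is color consistent if $color(u)=color(v)\iff color(\sigma(u))=color(\sigma(v))$;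 then $\sigma/color$ is the induced map on colors, $\sigma/color(c)=color(\sigma(v))$ for any $v$ with $color(v)=c$. $\mathrm{ISO}(Q,Q')$ is the set of isomorphisms from $Q$ to $Q'$. Structural isomorphism: parse trees $T_g$, $T_h$ (rooted at $\oplus$ nodes or single nodes) of $G$ and $H$ are structurally isomorphic via a label map $\pi$ (written $T_g\cong^{\pi}T_h$) if either (1) both are single nodes, or (2) $g$ and $h$ have immediate significant descendants $g_1,\dots,g_r$ and $h_1,\dots,h_r$ respectively and there is a bijection $\gamma:[r]\to[r]$ such that for each $i$ there is a $\pi_i\in\mathrm{ISO}(Q_{g_i},Q_{h_{\gamma(i)}})$ with $T_{g_i}\cong^{\pi_i}T_{h_{\gamma(i)}}$ and $\pi_i/color=\pi|_{color(Q_{g_i})}$. -}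

module Defs where

open import Data.Nat using (ℕ; _≡ᵇ_)
open import Data.Bool using (Bool; true; false; if_then_else_; _∨_; _∧_)
open import Data.List using (List; []; _∷_; _++_; map; concatMap; length; lookup; foldl)
open import Data.List.Membership.Propositional using (_∈_)
open import Data.Product using (Σ; _×_; _,_; proj₁; proj₂; ∃)
open import Data.Unit using (⊤)
open import Data.Fin using (Fin)
open import Data.Fin.Permutation using (Permutation; _⟨$⟩ʳ_)
open import Relation.Binary.PropositionalEquality using (_≡_; _≢_)
open import Function.Bundles using (_⇔_)

Label : Set
Label = ℕ

-- Clique-width expressions = parse trees.
--   vtx v i   : new vertex v with label i
--   plus es   : disjoint union of any number of labeled graphs
--   eta i j   : add all edges between labels i and j  (i ≠ j)
--   rho i j   : relabel i to j
data Expr : Set where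
  vtx  : ℕ → Label → Expr
  plus : List Expr → Expr
  eta  : (i j : Label) → i ≢ j → Expr → Expr
  rho  : (i j : Label) → Expr → Expr

relabel : Label → Label → Label → Label
relabel i j x = if x ≡ᵇ i then j else x

-- lab(G_x): the labels of the graph generated by the expression
-- (as a list; duplicates are irrelevant since only membership is used)
mutual
  labs : Expr → List Label
  labs (vtx v i)   = i ∷ []
  labs (plus es)   = labsL es
  labs (eta i j _ e) = labs e
  labs (rho i j e) = map (relabel i j) (labs e)

  labsL : List Expr → List Label
  labsL []       = []
  labsL (e ∷ es) = labs e ++ labsL es

-- operations that can lie on a path between a ⊕ node and an
-- immediate significant descendant
data Op : Set where
  etaOp : Label → Label → Op
  rhoOp : Label → Label → Op

-- strip e = (ops, d): d is the first node below (or at) e that is a ⊕ node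
-- or a leaf, and ops lists the η/ρ operations on the path from d up to e,
-- in bottom-up order (the order in which they are processed).
strip : Expr → List Op × Expr
strip (vtx v i)     = [] , vtx v i
strip (plus es)     = [] , plus es
strip (eta i j _ e) = proj₁ (strip e) ++ (etaOp i j ∷ []) , proj₂ (strip e)
strip (rho i j e)   = proj₁ (strip e) ++ (rhoOp i j ∷ []) , proj₂ (strip e)

isd : List Expr → List (List Op × Expr)
isd = map strip

record CGraph : Set where
  field
    verts : List Label
    col   : Label → Label
    adj   : Label → Label → Bool
open CGraph public

step : (Label → Label) × (Label → Label → Bool) → Op
     → (Label → Label) × (Label → Label → Bool)
step (c , ad) (etaOp a b) =
  c , (λ u v → ad u v ∨ ((c u ≡ᵇ a) ∧ (c v ≡ᵇ b)) ∨ ((c u ≡ᵇ b) ∧ (c v ≡ᵇ a)))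
step (c , ad) (rhoOp a b) = (λ u → relabel a b (c u)) , ad

quotient : List Op × Expr → CGraph
quotient (ops , d) =
  let st = foldl step ((λ a → a) , (λ _ _ → false)) ops
  in record { verts = labs d ; col = proj₁ st ; adj = proj₂ st }

record IsISO (σ : Label → Label) (Q Q' : CGraph) : Set where
  field
    maps   : ∀ {u} → u ∈ verts Q → σ u ∈ verts Q'
    inj    : ∀ {u v} → u ∈ verts Q → v ∈ verts Q → σ u ≡ σ v → u ≡ v
    surj   : ∀ {w} → w ∈ verts Q' → Σ Label (λ u → u ∈ verts Q × σ u ≡ w)
    edges  : ∀ {u v} → u ∈ verts Q → v ∈ verts Q → adj Q u v ≡ adj Q' (σ u) (σ v)
    colcon : ∀ {u v} → u ∈ verts Q → v ∈ verts Q →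
             (col Q u ≡ col Q v) ⇔ (col Q' (σ u) ≡ col Q' (σ v))

-- σ/color = π restricted to color(Q):  for every vertex v of Q,
-- σ/color(color(v)) = color(σ(v)) equals π(color(v)).
ColorAgrees : (σ : Label → Label) (Q Q' : CGraph) (π : Label → Label) → Set
ColorAgrees σ Q Q' π = ∀ {v} → v ∈ verts Q → col Q' (σ v) ≡ π (col Q v)

data StructIso : Expr → (Label → Label) → Expr → Set where
  single : ∀ {u i v j π} → StructIso (vtx u i) π (vtx v j)
  node   : ∀ {ds es π} →
           (γ : Permutation (length (isd ds)) (length (isd es))) →
           (∀ k → let gk = lookup (isd ds) k
                      hk = lookup (isd es) (γ ⟨$⟩ʳ k)
                  in Σ (Label → Label) λ πk →
                       IsISO πk (quotient gk) (quotient hk)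
                     × StructIso (proj₂ gk) πk (proj₂ hk)
                     × ColorAgrees πk (quotient gk) (quotient hk) π) →
           StructIso (plus ds) π (plus es)

_≅⟨_⟩_ : Expr → (Label → Label) → Expr → Set
g ≅⟨ π ⟩ h = StructIso g π h

module Submission where

-- At two ⊕ nodes the bijections
-- γ₁, γ₂ between immediate significant descendants compose to γ₂ ∘ γ₁;
-- a descendant g_k is matched via γ₁ to some h and h via γ₂ to some h',
-- and the witnessing quotient isomorphisms σ : Q_{g_k} → Q_h and
-- τ : Q_h → Q_{h'} compose to τ ∘ σ.  Two general facts about colored
-- graphs justify this:
--   * isomorphisms of colored graphs compose (IsISO-∘), and
--   * if σ/color agrees with π₁ and τ/color agrees with π₂, then
--     (τ ∘ σ)/color agrees with π₂ ∘ π₁ (ColorAgrees-∘).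
-- The subtrees are related by τ ∘ σ by the induction hypothesis.

open import Defs
open import Function using (_∘_)
open import Data.Product using (Σ; _×_; _,_; proj₂)
open import Data.List using (List; lookup)
open import Data.List.Membership.Propositional using (_∈_)
open import Data.Fin.Permutation using (_⟨$⟩ʳ_; _∘ₚ_)
open import Relation.Binary.PropositionalEquality using (_≡_; trans; cong)
open import Function.Construct.Composition using (_⇔-∘_)

IsISO-∘ : ∀ {σ τ Q₁ Q₂ Q₃} →
          IsISO σ Q₁ Q₂ → IsISO τ Q₂ Q₃ → IsISO (τ ∘ σ) Q₁ Q₃
IsISO-∘ {σ} {τ} {Q₁} {Q₃ = Q₃} σ-iso τ-iso = record
  { maps   = λ u → T.maps (S.maps u)
  ; inj    = λ u v στu≡στv → S.inj u v (T.inj (S.maps u) (S.maps v) στu≡στv)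
  ; surj   = surj
  ; edges  = λ u v → trans (S.edges u v) (T.edges (S.maps u) (S.maps v))
  ; colcon = λ u v → T.colcon (S.maps u) (S.maps v) ⇔-∘ S.colcon u v
  }
  where
    module S = IsISO σ-iso
    module T = IsISO τ-iso

    surj : ∀ {w} → w ∈ verts Q₃ → Σ Label λ u → u ∈ verts Q₁ × τ (σ u) ≡ w
    surj w∈ with T.surj w∈
    ... | x , x∈ , τx≡w with S.surj x∈
    ...   | y , y∈ , σy≡x = y , y∈ , trans (cong τ σy≡x) τx≡w

ColorAgrees-∘ : ∀ {σ τ Q₁ Q₂ Q₃ π₁ π₂} → IsISO σ Q₁ Q₂ →
                ColorAgrees σ Q₁ Q₂ π₁ → ColorAgrees τ Q₂ Q₃ π₂ →
                ColorAgrees (τ ∘ σ) Q₁ Q₃ (π₂ ∘ π₁)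
ColorAgrees-∘ {π₂ = π₂} σ-iso σ-agrees τ-agrees v∈ =
  trans (τ-agrees (IsISO.maps σ-iso v∈)) (cong π₂ (σ-agrees v∈))

-- A matching of two immediate significant descendants g, h (each given with
-- the operations on its path to the ⊕ node) over the label map π: the
-- per-descendant data required by the ⊕ case of structural isomorphism.
Matched : (Label → Label) → List Op × Expr → List Op × Expr → Set
Matched π g h = Σ (Label → Label) λ σ →
    IsISO σ (quotient g) (quotient h)
  × StructIso (proj₂ g) σ (proj₂ h)
  × ColorAgrees σ (quotient g) (quotient h) π

-- Since quotient is not injective, the descendants and label maps are passed
-- explicitly where unification cannot recover them.
mutual
  Matched-∘ : ∀ {g h h' π₁ π₂} →
              Matched π₁ g h → Matched π₂ h h' → Matched (π₂ ∘ π₁) g h'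
  Matched-∘ {h' = h'} {π₁} {π₂}
            (σ , σ-iso , sub₁ , σ-agrees) (τ , τ-iso , sub₂ , τ-agrees) =
    τ ∘ σ , IsISO-∘ σ-iso τ-iso , lemma2 sub₁ sub₂
          , ColorAgrees-∘ {Q₃ = quotient h'} {π₁} {π₂} σ-iso σ-agrees τ-agrees

  lemma2 : ∀ {g₁ g₂ g₃ : Expr} {π₁ π₂ : Label → Label} →
           g₁ ≅⟨ π₁ ⟩ g₂ → g₂ ≅⟨ π₂ ⟩ g₃ → g₁ ≅⟨ π₂ ∘ π₁ ⟩ g₃
  lemma2 single single = single
  lemma2 {π₁ = π₁} {π₂} (node {ds₁} {ds₂} γ₁ match₁) (node {es = ds₃} γ₂ match₂) =
    node (γ₁ ∘ₚ γ₂) λ k →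
      let j = γ₁ ⟨$⟩ʳ k in
      Matched-∘ {lookup (isd ds₁) k} {lookup (isd ds₂) j}
                {lookup (isd ds₃) (γ₂ ⟨$⟩ʳ j)} {π₁} {π₂}
                (match₁ k) (match₂ j)
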